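{- Let $G$ be a disconnected graph with connected components $G_1,\dots,G_n$ ($n\ge 2$), and for each $i$ let $w_i$ be a square-free word representing $G_i$. Assume $G_1$ has at least one edge. Let $a$ be the last letter of $w_1$, let $w_1^{ - }$ denote $w_1$ with its last letter deleted, and let $\sigma(w_1)^{ - }$ denote $\sigma(w_1)$ with its last letter (which is $a$) deleted. Then the word $$w = w_1^{ - }\, w_2 w_3\cdots w_n\, a\, \sigma(w_n)\cdots\sigma(w_3)\sigma(w_2)\,\sigma(w_1)^{ - }\,\sigma(w_2)\sigma(w_3)\cdots\sigma(w_n)\, a$$ represents $G$ and is square-free.
   Context: A word $w$ over the alphabet $V$ represents the simple graph $G=(V,E)$ if every letter of $V$ occurs in $w$ and, for all distinct $x,y\in V$, $x$ and $y$ alternate in $w$ (deleting all other letters leaves $xyxy\cdots$ or $yxyx\cdots$) if and only if $xy\in E$. For a word $w$, the final permutation $\sigma(w)$ is the word obtained from $w$ by deleting all but the rightmost occurrence of each letter. A square is a factor $XX$ with $X$ non-empty; a word is square-free if it contains no square. -}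

module Defs where

open import Data.Nat using (ℕ; _≟_)
open import Data.Bool using (Bool; true; false; if_then_else_; _∨_)
open import Data.List using (List; []; _∷_; _++_; [_]; concat; map; reverse)
open import Data.List.Membership.Propositional using (_∈_; _∉_)
open import Data.List.Membership.DecPropositional _≟_ using (_∈?_)
open import Data.List.Relation.Unary.All using (All)
open import Data.List.Relation.Unary.Any using (Any)
open import Data.List.Relation.Unary.AllPairs using (AllPairs)
open import Data.Product using (Σ; _×_; _,_; ∃; ∃-syntax; proj₁; proj₂)
open import Data.Unit using (⊤)
open import Relation.Nullary using (¬_; does)
open import Relation.Binary.PropositionalEquality using (_≡_; _≢_)
open import Function.Bundles using (_⇔_)

Word : Set
Word = List ℕ

record Graph : Set₁ where
  field
    V      : List ℕ
    E      : ℕ → ℕ → Set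
    E-sym  : ∀ {x y} → E x y → E y x
    E-irr  : ∀ {x} → ¬ E x x
    E-inV  : ∀ {x y} → E x y → x ∈ V × y ∈ V
open Graph public

restrict : ℕ → ℕ → Word → Word
restrict x y [] = []
restrict x y (z ∷ w) =
  if does (z ≟ x) ∨ does (z ≟ y) then z ∷ restrict x y w else restrict x y w

NoAdjRepeat : Word → Set
NoAdjRepeat [] = ⊤
NoAdjRepeat (a ∷ []) = ⊤
NoAdjRepeat (a ∷ b ∷ l) = a ≢ b × NoAdjRepeat (b ∷ l)

Alternate : ℕ → ℕ → Word → Set
Alternate x y w = NoAdjRepeat (restrict x y w)

Represents : Word → Graph → Set
Represents w G =
  (∀ x → (x ∈ w) ⇔ (x ∈ V G)) ×
  (∀ x y → x ∈ V G → y ∈ V G → x ≢ y → Alternate x y w ⇔ E G x y)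

SquareFree : Word → Set
SquareFree w = ¬ (Σ Word λ u → Σ Word λ X → Σ Word λ v → X ≢ [] × w ≡ u ++ X ++ X ++ v)

σ : Word → Word
σ [] = []
σ (x ∷ w) = if does (x ∈? w) then σ w else x ∷ σ w

removeLast : Word → Word
removeLast [] = []
removeLast (x ∷ []) = []
removeLast (x ∷ y ∷ l) = x ∷ removeLast (y ∷ l)

data Reach (G : Graph) : ℕ → ℕ → Set where
  here : ∀ {x} → Reach G x x
  step : ∀ {x y z} → E G x y → Reach G y z → Reach G x z

Connected : Graph → Set
Connected G = (∃[ x ] x ∈ V G) × (∀ x y → x ∈ V G → y ∈ V G → Reach G x y)

HasEdge : Graph → Set
HasEdge G = ∃[ x ] ∃[ y ] E G x y

IsComponents : Graph → List Graph → Set₁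
IsComponents G Gs =
  All Connected Gs ×
  All (λ H → ∀ x y → x ∈ V H → y ∈ V H → E H x y ⇔ E G x y) Gs ×
  (∀ x → x ∈ V G ⇔ Any (λ H → x ∈ V H) Gs) ×
  AllPairs (λ H K → ∀ x → x ∈ V H → x ∉ V K) Gs ×
  AllPairs (λ H K → ∀ x y → x ∈ V H → y ∈ V K → ¬ E G x y) Gs

-- the word of the theorem, with ws = [w₂, …, wₙ]
bigWord : Word → ℕ → Word → List Word → Word
bigWord w₁ a w₁⁻ ws =
  w₁⁻ ++ concat ws ++ [ a ] ++ concat (reverse (map σ ws)) ++
  removeLast (σ w₁) ++ concat (map σ ws) ++ [ a ]

-- Write W = w⁻ P a R s S a with P = w₂⋯wₙ, R = σ(wₙ)⋯σ(w₂), S = σ(w₂)⋯σ(wₙ) and s = σ(w₁)⁻,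
-- which is nonempty because G₁ has an edge. Components have disjoint alphabets, so the trace of W
-- on two letters x, y only sees the blocks containing them. If x and y lie in one wᵢ, the trace is
-- that of wᵢ followed by one (i = 1) or two copies of that of σ(wᵢ); an alternating word over
-- {x, y} ends with its own final permutation, so appending it preserves alternation. If x and y lie
-- in different components, two adjacent blocks put the same letter side by side: P and R, or R and
-- S, when one of them is in w₁, and otherwise R and S, whose traces are mirror images.
-- A square of W lies in w⁻P, lies in RsS (where the distinct letters of s occur nowhere else), or
-- straddles one of the two displayed a's; the latter forces a letter of another component to precede
-- a letter of w₁ inside w⁻P, or a factor aa in w₁.

module Submission where

open import Defs
open import Data.Nat using (ℕ; _≤_; _≟_; _≡ᵇ_)
open import Data.Nat.Properties using (≡ᵇ⇒≡; ≡⇒≡ᵇ)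
open import Data.Bool as Bool using (true; false)
open import Data.Unit using (tt)
open import Data.List using (List; []; _∷_; _++_; [_]; _∷ʳ_; concat; map; reverse; length; initLast; _∷ʳ′_)
open import Data.List.Properties using (++-assoc; ++-identityʳ; ∷-injective; concat-++; unfold-reverse; reverse-++)
open import Data.List.Membership.Propositional using (_∈_; _∉_; find; lose)
open import Data.List.Membership.DecPropositional _≟_ using (_∈?_)
open import Data.List.Membership.Propositional.Properties using (∈-++⁺ˡ; ∈-++⁺ʳ; ∈-++⁻; ∈-concat⁺; ∈-concat⁻; ∈-concat⁺′; ∈-map⁺)
open import Data.List.Relation.Unary.Any as Any using (Any; here; there)
import Data.List.Relation.Unary.Any.Properties as AnyP
open import Data.List.Relation.Unary.All as All using (All; []; _∷_)
open import Data.List.Relation.Unary.AllPairs as AllPairs using (AllPairs; []; _∷_)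
import Data.List.Relation.Unary.AllPairs.Properties as AllPairsP
open import Data.List.Relation.Unary.Unique.Propositional using (Unique)
open import Data.List.Relation.Unary.All.Properties as AllP using (All¬⇒¬Any)
open import Data.List.Relation.Binary.Disjoint.Propositional using (Disjoint; contractₗ)
open import Data.List.Relation.Binary.Disjoint.Propositional.Properties using (concat⁺ʳ)
  renaming (sym to #-sym)
open import Data.Product as Prod using (Σ; _×_; _,_; ∃-syntax; proj₁; proj₂)
open import Data.Sum as Sum using (_⊎_; inj₁; inj₂)
open import Data.Empty using (⊥; ⊥-elim)
open import Relation.Nullary using (¬_; Dec; yes; no; _×-dec_)
open import Function using (_∘_; case_of_)
open import Function.Bundles using (_⇔_; mk⇔; Equivalence)
open import Function.Properties.Equivalence using () renaming (trans to ⇔-trans; sym to ⇔-sym)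
open import Relation.Binary.PropositionalEquality
  using (_≡_; _≢_; refl; sym; trans; cong; cong₂; subst; subst₂; module ≡-Reasoning)

open ≡-Reasoning

++-cut : ∀ {A : Set} (a b c d : List A) → a ++ b ≡ c ++ d →
  (∃[ m ] c ≡ a ++ m × b ≡ m ++ d) ⊎ (∃[ m ] a ≡ c ++ m × d ≡ m ++ b)
++-cut []      b c       d eq = inj₁ (c , refl , eq)
++-cut (x ∷ a) b []      d eq = inj₂ (x ∷ a , refl , sym eq)
++-cut (x ∷ a) b (y ∷ c) d eq with ∷-injective eq
... | refl , eq′ with ++-cut a b c d eq′
...   | inj₁ (m , c≡ , b≡) = inj₁ (m , cong (x ∷_) c≡ , b≡)
...   | inj₂ (m , a≡ , d≡) = inj₂ (m , cong (x ∷_) a≡ , d≡)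

∈-++-∷ : ∀ {A : Set} {x : A} a b → x ∈ a ++ x ∷ b
∈-++-∷ a b = ∈-++⁺ʳ a (here refl)

∉-++⁺ : ∀ {z : ℕ} u v → z ∉ u → z ∉ v → z ∉ u ++ v
∉-++⁺ u v z∉u z∉v z∈u++v with ∈-++⁻ u z∈u++v
... | inj₁ z∈u = z∉u z∈u
... | inj₂ z∈v = z∉v z∈v

∈⇒≢[] : ∀ {A : Set} {z : A} {l} → z ∈ l → l ≢ []
∈⇒≢[] z∈l refl with z∈l
... | ()

++-no-crossing : ∀ {p q : ℕ} u v l n → u ++ v ≡ l ++ p ∷ n → q ∈ n → p ∉ u → q ∉ v → ⊥
++-no-crossing u v l n eq q∈n p∉u q∉v with ++-cut u v l (_ ∷ n) eq
... | inj₁ (m , _ , v≡) = q∉v (subst (_ ∈_) (sym v≡) (∈-++⁺ʳ m (there q∈n)))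
... | inj₂ ([] , _ , p∷n≡v) = q∉v (subst (_ ∈_) p∷n≡v (there q∈n))
... | inj₂ (x ∷ m , u≡ , p∷n≡) with ∷-injective p∷n≡
...   | refl , _ = p∉u (subst (_ ∈_) (sym u≡) (∈-++-∷ l m))

last-∈ : ∀ {q : ℕ} u v l → v ≢ [] → u ++ v ≡ l ++ [ q ] → q ∈ v
last-∈ u v l v≢[] eq with ++-cut u v l [ _ ] eq
... | inj₁ (m , _ , v≡) = subst (_ ∈_) (sym v≡) (∈-++-∷ m [])
... | inj₂ ([] , _ , [q]≡v) = subst (_ ∈_) [q]≡v (here refl)
... | inj₂ (_ ∷ [] , _ , eq′) = ⊥-elim (v≢[] (sym (proj₂ (∷-injective eq′))))
... | inj₂ (_ ∷ _ ∷ _ , _ , ())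

∷-align : ∀ {c : ℕ} A B L N → c ∉ N → A ++ c ∷ B ≡ L ++ c ∷ N →
  ∃[ m ] ∃[ k ] B ≡ m ++ N × L ≡ A ++ k
∷-align {c} A B L N c∉N eq with ++-cut A (c ∷ B) L (c ∷ N) eq
... | inj₁ ([] , L≡ , c∷B≡) = [] , [] , proj₂ (∷-injective c∷B≡) , L≡
... | inj₁ (_ ∷ m , L≡ , c∷B≡) with ∷-injective c∷B≡
...   | refl , B≡ = m ++ [ c ] , c ∷ m , trans B≡ (sym (++-assoc m [ c ] N)) , L≡
∷-align {c} A B L N c∉N eq | inj₂ ([] , A≡ , c∷N≡) =
  [] , [] , sym (proj₂ (∷-injective c∷N≡)) ,
  trans (sym (++-identityʳ L)) (trans (sym A≡) (sym (++-identityʳ A)))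
∷-align {c} A B L N c∉N eq | inj₂ (_ ∷ m , _ , c∷N≡) with ∷-injective c∷N≡
... | refl , N≡ = ⊥-elim (c∉N (subst (c ∈_) (sym N≡) (∈-++-∷ m B)))

unique-∷ʳ⁻ : ∀ (s : Word) a → Unique (s ∷ʳ a) → Unique s × a ∉ s
unique-∷ʳ⁻ []      a _            = [] , λ ()
unique-∷ʳ⁻ (c ∷ s) a (c∉sa ∷ !sa) with unique-∷ʳ⁻ s a !sa
... | !s , a∉s = AllP.++⁻ˡ s c∉sa ∷ !s , λ
  { (here refl) → All.lookup c∉sa (∈-++-∷ s []) refl
  ; (there a∈s) → a∉s a∈s }

concat-reverse-∷ : ∀ (u : Word) us → concat (reverse (u ∷ us)) ≡ concat (reverse us) ++ u
concat-reverse-∷ u us = begin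
  concat (reverse (u ∷ us))           ≡⟨ cong concat (unfold-reverse u us) ⟩
  concat (reverse us ++ [ u ])        ≡⟨ concat-++ (reverse us) [ u ] ⟨
  concat (reverse us) ++ u ++ []      ≡⟨ cong (concat (reverse us) ++_) (++-identityʳ u) ⟩
  concat (reverse us) ++ u            ∎

∈-concat-reverse⁻ : ∀ (us : List Word) {z} → z ∈ concat (reverse us) → z ∈ concat us
∈-concat-reverse⁻ us z∈ = ∈-concat⁺ {xss = us} (AnyP.reverse⁻ (∈-concat⁻ (reverse us) z∈))

∈-concat-reverse⁺ : ∀ (us : List Word) {z} → z ∈ concat us → z ∈ concat (reverse us)
∈-concat-reverse⁺ us z∈ = ∈-concat⁺ {xss = reverse us} (AnyP.reverse⁺ (∈-concat⁻ us z∈))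

reverse-constant-unique : ∀ {c : ℕ} l → All (_≡ c) l → Unique l → reverse l ≡ l
reverse-constant-unique []           _                 _                  = refl
reverse-constant-unique (_ ∷ [])     _                 _                  = refl
reverse-constant-unique (_ ∷ _ ∷ _) (refl ∷ refl ∷ _) ((z≢z′ ∷ _) ∷ _) = ⊥-elim (z≢z′ refl)

all-reverse : ∀ {A : Set} {P : A → Set} {xs} → All P xs → All P (reverse xs)
all-reverse Pxs = All.tabulate (All.lookup Pxs ∘ AnyP.reverse⁻)

allPairs-reverse : ∀ {A : Set} {R : A → A → Set} → (∀ {u v} → R u v → R v u) →
  ∀ {xs} → AllPairs R xs → AllPairs R (reverse xs)
allPairs-reverse R-sym {[]}     []          = []
allPairs-reverse R-sym {x ∷ xs} (Rx ∷ Rxs) = subst (AllPairs _) (sym (unfold-reverse x xs))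
  (AllPairsP.++⁺ (allPairs-reverse R-sym Rxs) ([] ∷ [])
    (All.tabulate λ z∈ → R-sym (All.lookup Rx (AnyP.reverse⁻ z∈)) ∷ []))

allPairs-with : ∀ {a} {A : Set a} {R S : A → A → Set} {Q : A → Set} →
  (∀ {u v} → Q u → Q v → R u v → S u v) → ∀ {xs} → All Q xs → AllPairs R xs → AllPairs S xs
allPairs-with f []         []         = []
allPairs-with f (Qx ∷ Qxs) (Rx ∷ Rxs) =
  All.zipWith (λ (Qy , Rxy) → f Qx Qy Rxy) (Qxs , Rx) ∷ allPairs-with f Qxs Rxs

any-pair : ∀ {a} {A : Set a} {R : A → A → Set} {P Q : A → Set} {xs} →
  AllPairs R xs → Any P xs → Any Q xs →
  Any (λ z → P z × Q z) xs ⊎ (∃[ u ] ∃[ v ] R u v × P u × Q v) ⊎ (∃[ u ] ∃[ v ] R u v × Q u × P v)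
any-pair (_  ∷ _)   (here Px)  (here Qx)  = inj₁ (here (Px , Qx))
any-pair (Rx ∷ _)   (here Px)  (there Qy) =
  let (Rxz , Qz) = All.lookupAny Rx Qy in inj₂ (inj₁ (_ , _ , Rxz , Px , Qz))
any-pair (Rx ∷ _)   (there Py) (here Qx)  =
  let (Rxz , Pz) = All.lookupAny Rx Py in inj₂ (inj₂ (_ , _ , Rxz , Qx , Pz))
any-pair (_  ∷ Rxs) (there Py) (there Qy) with any-pair Rxs Py Qy
... | inj₁ both = inj₁ (there both)
... | inj₂ rel  = inj₂ rel

-- Squares

HasSquare : Word → Set
HasSquare w = Σ Word λ u → Σ Word λ X → Σ Word λ v → X ≢ [] × w ≡ u ++ X ++ X ++ v

squareFree-[] : SquareFree []
squareFree-[] (_ , [] , _ , X≢[] , _) = X≢[] refl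
squareFree-[] ([] , _ ∷ _ , _ , _ , ())
squareFree-[] (_ ∷ _ , _ , _ , _ , ())

squareFree-++⁻ˡ : ∀ A B → SquareFree (A ++ B) → SquareFree A
squareFree-++⁻ˡ A B sf (u , X , v , X≢[] , A≡) = sf (u , X , v ++ B , X≢[] , (begin
  A ++ B                  ≡⟨ cong (_++ B) A≡ ⟩
  (u ++ X ++ X ++ v) ++ B ≡⟨ ++-assoc u (X ++ X ++ v) B ⟩
  u ++ (X ++ X ++ v) ++ B ≡⟨ cong (u ++_) (++-assoc X (X ++ v) B) ⟩
  u ++ X ++ (X ++ v) ++ B ≡⟨ cong (λ t → u ++ X ++ t) (++-assoc X v B) ⟩
  u ++ X ++ X ++ v ++ B   ∎))

square-cut : ∀ M D u X v → X ≢ [] → u ++ X ++ X ++ v ≡ M ++ D →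
    (∃[ m ] D ≡ m ++ X ++ X ++ v)
  ⊎ (∃[ m ] ∃[ k ] M ≡ u ++ m × X ≡ m ++ k × D ≡ k ++ X ++ v)
  ⊎ HasSquare M
  ⊎ (∃[ k₀ ] ∃[ k ] ∃[ m ] M ≡ u ++ X ++ m × X ≡ m ++ k₀ ∷ k × D ≡ k₀ ∷ k ++ v)
square-cut M D u X v X≢[] eq with ++-cut u (X ++ X ++ v) M D eq
... | inj₂ (m , _ , D≡) = inj₁ (m , D≡)
... | inj₁ (m , M≡ , XXv≡) with ++-cut X (X ++ v) m D XXv≡
...   | inj₂ (k , X≡ , D≡) = inj₂ (inj₁ (m , k , M≡ , X≡ , D≡))
...   | inj₁ (m′ , m≡ , Xv≡) with ++-cut X v m′ D Xv≡
...     | inj₁ (j , m′≡ , _) = inj₂ (inj₂ (inj₁ (u , X , j , X≢[] , (begin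
          M                ≡⟨ M≡ ⟩
          u ++ m           ≡⟨ cong (u ++_) m≡ ⟩
          u ++ X ++ m′     ≡⟨ cong (λ t → u ++ X ++ t) m′≡ ⟩
          u ++ X ++ X ++ j ∎))))
...     | inj₂ ([] , X≡ , _) = inj₂ (inj₂ (inj₁ (u , X , [] , X≢[] , (begin
          M                 ≡⟨ M≡ ⟩
          u ++ m            ≡⟨ cong (u ++_) m≡ ⟩
          u ++ X ++ m′      ≡⟨ cong (λ t → u ++ X ++ t) (sym (trans X≡ (++-identityʳ m′))) ⟩
          u ++ X ++ X       ≡⟨ cong (λ t → u ++ X ++ t) (sym (++-identityʳ X)) ⟩
          u ++ X ++ X ++ [] ∎))))
...     | inj₂ (k₀ ∷ k , X≡ , D≡) =
          inj₂ (inj₂ (inj₂ (k₀ , k , m′ , trans M≡ (cong (u ++_) m≡) , X≡ , D≡)))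

-- A square y c z y c z in M ++ c ∷ N, with the displayed c as its second c.
Straddles : Word → ℕ → Word → Set
Straddles M c N = ∃[ u ] ∃[ y ] ∃[ z ] ∃[ v ] M ≡ u ++ y ++ c ∷ z ++ y × N ≡ z ++ v

square-around : ∀ M c N → c ∉ N → HasSquare (M ++ c ∷ N) →
  HasSquare M ⊎ HasSquare N ⊎ Straddles M c N
square-around M c N c∉N (u , X , v , X≢[] , eq) with square-cut M (c ∷ N) u X v X≢[] (sym eq)
... | inj₂ (inj₂ (inj₁ sqM)) = inj₁ sqM
... | inj₁ (_ ∷ m , c∷N≡) = inj₂ (inj₁ (m , X , v , X≢[] , proj₂ (∷-injective c∷N≡)))
... | inj₁ ([] , c∷N≡) with X
...   | [] = ⊥-elim (X≢[] refl)
...   | _ ∷ X′ with ∷-injective c∷N≡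
...     | refl , N≡ = ⊥-elim (c∉N (subst (c ∈_) (sym N≡) (∈-++⁺ʳ X′ (here refl))))
square-around M c N c∉N (u , X , v , X≢[] , eq) | inj₂ (inj₂ (inj₂ (_ , k , m , M≡ , X≡ , c∷N≡)))
  with ∷-injective c∷N≡
... | refl , N≡ = inj₂ (inj₂ (u , m , k , v ,
        trans M≡ (trans (cong (λ t → u ++ t ++ m) X≡) (cong (u ++_) (++-assoc m (c ∷ k) m))) , N≡))
square-around M c N c∉N (u , X , v , X≢[] , eq) | inj₂ (inj₁ (m , _ ∷ k , M≡ , X≡ , c∷N≡))
  with ∷-injective c∷N≡
... | refl , N≡ = ⊥-elim (c∉N (subst (c ∈_) (sym N≡)
        (∈-++⁺ʳ k (∈-++⁺ˡ (subst (c ∈_) (sym X≡) (∈-++-∷ m k))))))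
square-around M c N c∉N (u , X , v , X≢[] , eq) | inj₂ (inj₁ (m , [] , M≡ , X≡ , c∷N≡))
  with X
... | [] = ⊥-elim (X≢[] refl)
... | _ ∷ X′ with ∷-injective c∷N≡
...   | refl , N≡ = inj₂ (inj₂ (u , [] , X′ , v ,
        trans M≡ (cong (u ++_) (trans (sym (trans X≡ (++-identityʳ m)))
                                      (cong (c ∷_) (sym (++-identityʳ X′))))) ,
        N≡))

squareFree-∷ : ∀ c N → c ∉ N → SquareFree N → SquareFree (c ∷ N)
squareFree-∷ c N c∉N sfN sq with square-around [] c N c∉N sq
... | inj₁ sq[] = squareFree-[] sq[]
... | inj₂ (inj₁ sqN) = sfN sqN
... | inj₂ (inj₂ ([] , [] , _ , _ , () , _))
... | inj₂ (inj₂ ([] , _ ∷ _ , _ , _ , () , _))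
... | inj₂ (inj₂ (_ ∷ _ , _ , _ , _ , () , _))

squareFree-unique-++ : ∀ s S → Unique s → Disjoint s S → SquareFree S → SquareFree (s ++ S)
squareFree-unique-++ []      S []           s#S sfS = sfS
squareFree-unique-++ (c ∷ s) S (c∉s ∷ !s) s#S sfS =
  squareFree-∷ c (s ++ S) (∉-++⁺ s S (All¬⇒¬Any c∉s) (λ c∈S → s#S (here refl , c∈S)))
    (squareFree-unique-++ s S !s (contractₗ s#S) sfS)

unique⇒squareFree : ∀ s → Unique s → SquareFree s
unique⇒squareFree s !s =
  subst SquareFree (++-identityʳ s) (squareFree-unique-++ s [] !s (λ ()) squareFree-[])

squareFree-++ : ∀ M N → SquareFree M → SquareFree N → Disjoint M N → SquareFree (M ++ N)
squareFree-++ M N sfM sfN M#N (u , X , v , X≢[] , eq) with square-cut M N u X v X≢[] (sym eq)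
... | inj₁ (m , N≡) = sfN (m , X , v , X≢[] , N≡)
... | inj₂ (inj₂ (inj₁ sqM)) = sfM sqM
... | inj₂ (inj₂ (inj₂ (k₀ , k , m , M≡ , X≡ , N≡))) =
  M#N ( subst (k₀ ∈_) (sym M≡) (∈-++⁺ʳ u (∈-++⁺ˡ (subst (k₀ ∈_) (sym X≡) (∈-++-∷ m k))))
      , subst (k₀ ∈_) (sym N≡) (here refl))
... | inj₂ (inj₁ ([] , k , M≡ , X≡ , N≡)) =
  sfN ([] , X , v , X≢[] , trans N≡ (cong (_++ X ++ v) (sym X≡)))
... | inj₂ (inj₁ (m₀ ∷ m , k , M≡ , X≡ , N≡)) =
  M#N ( subst (m₀ ∈_) (sym M≡) (∈-++-∷ u m)
      , subst (m₀ ∈_) (sym N≡) (∈-++⁺ʳ k (∈-++⁺ˡ (subst (m₀ ∈_) (sym X≡) (here refl)))))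

squareFree-concat : ∀ us → All SquareFree us → AllPairs Disjoint us → SquareFree (concat us)
squareFree-concat []       []         []         = squareFree-[]
squareFree-concat (u ∷ us) (sf ∷ sfs) (u#us ∷ ds) =
  squareFree-++ u (concat us) sf (squareFree-concat us sfs ds) (concat⁺ʳ u#us)

squareFree-sandwich : ∀ R c s S → SquareFree R → SquareFree S → Unique (c ∷ s) →
  Disjoint (c ∷ s) R → Disjoint (c ∷ s) S → SquareFree (R ++ c ∷ s ++ S)
squareFree-sandwich R c s S sfR sfS (c∉s ∷ !s) cs#R cs#S sq
  with square-around R c (s ++ S) (∉-++⁺ s S (All¬⇒¬Any c∉s) (λ c∈S → cs#S (here refl , c∈S))) sq
... | inj₁ sqR = sfR sqR
... | inj₂ (inj₁ sqsS) = squareFree-unique-++ s S !s (contractₗ cs#S) sfS sqsS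
... | inj₂ (inj₂ (u , y , z , _ , R≡ , _)) =
  cs#R (here refl , subst (c ∈_) (sym R≡) (∈-++⁺ʳ u (∈-++-∷ y (z ++ y))))

straddle-impossible : ∀ w P a r₀ T u y z v →
  SquareFree (w ++ [ a ]) → a ∉ P → Disjoint w P → r₀ ∉ w → P ≢ [] →
  w ++ P ≡ u ++ y ++ a ∷ z ++ y → r₀ ∷ T ≡ z ++ v → ⊥
straddle-impossible w P a r₀ T u y z v sf a∉P w#P r₀∉w P≢[] eq T≡ with initLast y
... | y′ ∷ʳ′ q = ++-no-crossing w P (u ++ y′) (a ∷ z ++ y′ ∷ʳ q) (begin
        w ++ P                                  ≡⟨ eq ⟩
        u ++ (y′ ∷ʳ q) ++ a ∷ z ++ y′ ∷ʳ q      ≡⟨ cong (u ++_) (++-assoc y′ [ q ] _) ⟩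
        u ++ y′ ++ q ∷ a ∷ z ++ y′ ∷ʳ q         ≡⟨ ++-assoc u y′ _ ⟨
        (u ++ y′) ++ q ∷ a ∷ z ++ y′ ∷ʳ q       ∎)
      (here refl) (λ q∈w → w#P (q∈w , q∈P)) a∉P
  where
  q∈P : q ∈ P
  q∈P = last-∈ w P (u ++ (y′ ∷ʳ q) ++ a ∷ z ++ y′) P≢[] (begin
    w ++ P                                     ≡⟨ eq ⟩
    u ++ (y′ ∷ʳ q) ++ a ∷ z ++ y′ ∷ʳ q         ≡⟨ cong (λ t → u ++ (y′ ∷ʳ q) ++ a ∷ t) (++-assoc z y′ [ q ]) ⟨
    u ++ (y′ ∷ʳ q) ++ (a ∷ z ++ y′) ++ [ q ]   ≡⟨ cong (u ++_) (++-assoc (y′ ∷ʳ q) (a ∷ z ++ y′) [ q ]) ⟨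
    u ++ ((y′ ∷ʳ q) ++ a ∷ z ++ y′) ++ [ q ]   ≡⟨ ++-assoc u _ [ q ] ⟨
    (u ++ (y′ ∷ʳ q) ++ a ∷ z ++ y′) ++ [ q ]   ∎)
... | [] with z
...   | [] = a∉P (last-∈ w P u P≢[] eq)
...   | r ∷ z′ with ∷-injective T≡ | ++-cut w P u (a ∷ r ∷ z′ ++ []) eq
...     | _ | inj₁ (m , _ , P≡) = a∉P (subst (a ∈_) (sym P≡) (∈-++-∷ m _))
...     | _ | inj₂ ([] , _ , a∷≡P) = a∉P (subst (a ∈_) a∷≡P (here refl))
...     | refl , _ | inj₂ (_ ∷ _ ∷ m , w≡ , a∷≡) with ∷-injective a∷≡
...       | _ , r≡ = r₀∉w (subst (r₀ ∈_) (sym w≡) (∈-++⁺ʳ u (there (here (proj₁ (∷-injective r≡))))))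
straddle-impossible w P a r₀ T u y z v sf a∉P w#P r₀∉w P≢[] eq T≡
  | [] | r ∷ z′ | _ | inj₂ (_ ∷ [] , w≡ , a∷≡) with ∷-injective a∷≡
... | refl , _ = sf (u , [ a ] , [] , (λ ()) , (begin
        w ++ [ a ]         ≡⟨ cong (_++ [ a ]) w≡ ⟩
        (u ++ [ a ]) ++ [ a ] ≡⟨ ++-assoc u [ a ] [ a ] ⟩
        u ++ [ a ] ++ [ a ] ++ [] ∎))

squareFree-construction : ∀ w P R s S a →
  SquareFree (w ++ [ a ]) → SquareFree P → SquareFree R → SquareFree S → Unique (s ∷ʳ a) →
  Disjoint (a ∷ w ++ s) (P ++ R ++ S) → P ≢ [] → R ≢ [] → s ≢ [] →
  SquareFree (w ++ P ++ [ a ] ++ R ++ s ++ S ++ [ a ])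
squareFree-construction w P [] s S a _ _ _ _ _ _ _ R≢[] _ = ⊥-elim (R≢[] refl)
squareFree-construction w P R [] S a _ _ _ _ _ _ _ _ s≢[] = ⊥-elim (s≢[] refl)
squareFree-construction w P R@(r₀ ∷ R′) s@(c ∷ s′) S a sfwa sfP sfR sfS !sa #PRS P≢[] _ _ =
  λ sq → outer (subst HasSquare word≡ sq)
  where
  L T : Word
  L = w ++ P
  T = R ++ s ++ S

  word≡ : w ++ P ++ [ a ] ++ R ++ s ++ S ++ [ a ] ≡ (L ++ a ∷ T) ++ [ a ]
  word≡ = sym (begin
    (L ++ a ∷ T) ++ [ a ]            ≡⟨ ++-assoc L (a ∷ T) [ a ] ⟩
    L ++ a ∷ T ++ [ a ]              ≡⟨ ++-assoc w P _ ⟩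
    w ++ P ++ a ∷ T ++ [ a ]         ≡⟨ cong (λ t → w ++ P ++ a ∷ t) (++-assoc R (s ++ S) [ a ]) ⟩
    w ++ P ++ a ∷ R ++ (s ++ S) ++ [ a ] ≡⟨ cong (λ t → w ++ P ++ a ∷ R ++ t) (++-assoc s S [ a ]) ⟩
    w ++ P ++ a ∷ R ++ s ++ S ++ [ a ]   ∎)

  !s = proj₁ (unique-∷ʳ⁻ s a !sa)

  a∉T : a ∉ T
  a∉T a∈T with ∈-++⁻ R a∈T
  ... | inj₁ a∈R = #PRS (here refl , ∈-++⁺ʳ P (∈-++⁺ˡ a∈R))
  ... | inj₂ a∈sS with ∈-++⁻ s a∈sS
  ...   | inj₁ a∈s = proj₂ (unique-∷ʳ⁻ s a !sa) a∈s
  ...   | inj₂ a∈S = #PRS (here refl , ∈-++⁺ʳ P (∈-++⁺ʳ R a∈S))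

  a∉P : a ∉ P
  a∉P a∈P = #PRS (here refl , ∈-++⁺ˡ a∈P)

  w#P : Disjoint w P
  w#P (i , j) = #PRS (there (∈-++⁺ˡ i) , ∈-++⁺ˡ j)

  r₀∉w : r₀ ∉ w
  r₀∉w i = #PRS (there (∈-++⁺ˡ i) , ∈-++⁺ʳ P (here refl))

  c∉P : c ∉ P
  c∉P j = #PRS (there (∈-++⁺ʳ w (here refl)) , ∈-++⁺ˡ j)

  s#R : Disjoint s R
  s#R (i , j) = #PRS (there (∈-++⁺ʳ w i) , ∈-++⁺ʳ P (∈-++⁺ˡ j))

  s#S : Disjoint s S
  s#S (i , j) = #PRS (there (∈-++⁺ʳ w i) , ∈-++⁺ʳ P (∈-++⁺ʳ R j))

  inner : HasSquare (L ++ a ∷ T) → ⊥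
  inner sq with square-around L a T a∉T sq
  ... | inj₁ sqL = squareFree-++ w P (squareFree-++⁻ˡ w [ a ] sfwa) sfP w#P sqL
  ... | inj₂ (inj₁ sqT) = squareFree-sandwich R c s′ S sfR sfS !s s#R s#S sqT
  ... | inj₂ (inj₂ (u , y , z , v , L≡ , T≡)) =
    straddle-impossible w P a r₀ (R′ ++ s ++ S) u y z v sfwa a∉P w#P r₀∉w P≢[] L≡ T≡

  -- At the last a the square is y a y a with T a factor of y, hence of w ++ P; but T starts
  -- with a letter outside w and later contains the letter c, which is outside P.
  outer : HasSquare ((L ++ a ∷ T) ++ [ a ]) → ⊥
  outer sq with square-around (L ++ a ∷ T) a [] (λ ()) sq
  ... | inj₁ sqLaT = inner sqLaT
  ... | inj₂ (inj₁ sq[]) = squareFree-[] sq[]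
  ... | inj₂ (inj₂ (_ , _ , _ ∷ _ , _ , _ , ()))
  ... | inj₂ (inj₂ (u , y , [] , _ , eq , _))
    with ∷-align (u ++ y) y L T a∉T (trans (++-assoc u y (a ∷ y)) (sym eq))
  ...   | m , k , y≡ , L≡ = ++-no-crossing w P (u ++ m) ((R′ ++ s ++ S) ++ k)
          (begin
            w ++ P               ≡⟨ L≡ ⟩
            (u ++ y) ++ k        ≡⟨ cong (λ t → (u ++ t) ++ k) y≡ ⟩
            (u ++ m ++ T) ++ k   ≡⟨ ++-assoc u (m ++ T) k ⟩
            u ++ (m ++ T) ++ k   ≡⟨ cong (u ++_) (++-assoc m T k) ⟩
            u ++ m ++ T ++ k     ≡⟨ ++-assoc u m (T ++ k) ⟨
            (u ++ m) ++ T ++ k   ∎)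
          (∈-++⁺ˡ (∈-++⁺ʳ R′ (here refl))) r₀∉w c∉P

-- Final permutations

σ-∷-∈ : ∀ {w : ℕ} l → w ∈ l → σ (w ∷ l) ≡ σ l
σ-∷-∈ {w} l w∈l with w ∈? l
... | yes _   = refl
... | no w∉l = ⊥-elim (w∉l w∈l)

σ-∷-∉ : ∀ {w : ℕ} l → w ∉ l → σ (w ∷ l) ≡ w ∷ σ l
σ-∷-∉ {w} l w∉l with w ∈? l
... | yes w∈l = ⊥-elim (w∉l w∈l)
... | no _    = refl

∈-σ⁻ : ∀ {z} l → z ∈ σ l → z ∈ l
∈-σ⁻ (w ∷ l) z∈ with w ∈? l
... | yes _ = there (∈-σ⁻ l z∈)
∈-σ⁻ (w ∷ l) (here z≡w)  | no _ = here z≡w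
∈-σ⁻ (w ∷ l) (there z∈) | no _ = there (∈-σ⁻ l z∈)

∈-σ⁺ : ∀ {z} l → z ∈ l → z ∈ σ l
∈-σ⁺ (w ∷ l) z∈ with w ∈? l
∈-σ⁺ (w ∷ l) (here refl) | yes w∈l = ∈-σ⁺ l w∈l
∈-σ⁺ (w ∷ l) (there z∈) | yes _   = ∈-σ⁺ l z∈
∈-σ⁺ (w ∷ l) (here z≡w)  | no _    = here z≡w
∈-σ⁺ (w ∷ l) (there z∈) | no _    = there (∈-σ⁺ l z∈)

σ-unique : ∀ l → Unique (σ l)
σ-unique []      = []
σ-unique (w ∷ l) with w ∈? l
... | yes _   = σ-unique l
... | no w∉l = All.tabulate (λ z∈ w≡z → w∉l (subst (_∈ l) (sym w≡z) (∈-σ⁻ l z∈))) ∷ σ-unique l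

σ-of-unique : ∀ l → Unique l → σ l ≡ l
σ-of-unique []      []            = refl
σ-of-unique (w ∷ l) (w∉l ∷ !l) =
  trans (σ-∷-∉ l (All¬⇒¬Any w∉l)) (cong (w ∷_) (σ-of-unique l !l))

σ-++-⊆ : ∀ u v → (∀ {z} → z ∈ u → z ∈ v) → σ (u ++ v) ≡ σ v
σ-++-⊆ []      v _   = refl
σ-++-⊆ (w ∷ u) v u⊆v =
  trans (σ-∷-∈ (u ++ v) (∈-++⁺ʳ u (u⊆v (here refl)))) (σ-++-⊆ u v (u⊆v ∘ there))

σ-++-σ : ∀ w → σ (w ++ σ w) ≡ σ w
σ-++-σ w = trans (σ-++-⊆ w (σ w) (∈-σ⁺ w)) (σ-of-unique (σ w) (σ-unique w))

σ-∷ʳ : ∀ l (a : ℕ) → ∃[ t ] σ (l ∷ʳ a) ≡ t ∷ʳ a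
σ-∷ʳ []      a = [] , refl
σ-∷ʳ (w ∷ l) a with w ∈? (l ∷ʳ a) | σ-∷ʳ l a
... | yes _ | t , eq = t , eq
... | no _  | t , eq = w ∷ t , cong (w ∷_) eq

removeLast-∷ʳ : ∀ t (a : ℕ) → removeLast (t ∷ʳ a) ≡ t
removeLast-∷ʳ []          a = refl
removeLast-∷ʳ (x ∷ [])    a = refl
removeLast-∷ʳ (x ∷ y ∷ t) a = cong (x ∷_) (removeLast-∷ʳ (y ∷ t) a)

σ-∷ʳ-removeLast : ∀ l (a : ℕ) → σ (l ∷ʳ a) ≡ removeLast (σ (l ∷ʳ a)) ∷ʳ a
σ-∷ʳ-removeLast l a with σ-∷ʳ l a
... | t , eq rewrite eq = cong (_∷ʳ a) (sym (removeLast-∷ʳ t a))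

∈-concat-σ⁻ : ∀ ws {z} → z ∈ concat (map σ ws) → z ∈ concat ws
∈-concat-σ⁻ ws z∈ = ∈-concat⁺ (Any.map (λ {w} → ∈-σ⁻ w) (AnyP.map⁻ (∈-concat⁻ (map σ ws) z∈)))

∈-concat-σ⁺ : ∀ ws {z} → z ∈ concat ws → z ∈ concat (map σ ws)
∈-concat-σ⁺ ws z∈ = ∈-concat⁺ (AnyP.map⁺ (Any.map (λ {w} → ∈-σ⁺ w) (∈-concat⁻ ws z∈)))

disjoint-σ : ∀ ws → AllPairs Disjoint ws → AllPairs Disjoint (map σ ws)
disjoint-σ ws #ws = AllPairsP.map⁺ (AllPairs.map (λ u#v {_} (i , j) → u#v (∈-σ⁻ _ i , ∈-σ⁻ _ j)) #ws)

σ-squareFree : ∀ ws → All SquareFree (map σ ws)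
σ-squareFree ws = AllP.map⁺ (All.universal (λ w → unique⇒squareFree (σ w) (σ-unique w)) ws)

-- Restriction to two letters

module _ (x y : ℕ) where

  XY : ℕ → Set
  XY z = z ≡ x ⊎ z ≡ y

  xy? : ∀ z → XY z ⊎ (z ≢ x × z ≢ y)
  xy? z with z ≟ x | z ≟ y
  ... | yes z≡x | _       = inj₁ (inj₁ z≡x)
  ... | no _    | yes z≡y = inj₁ (inj₂ z≡y)
  ... | no z≢x  | no z≢y  = inj₂ (z≢x , z≢y)

  -- restrict tests letters with _≡ᵇ_, to which _≟_ on ℕ reduces.
  restrict-∷-xy : ∀ {z} l → XY z → restrict x y (z ∷ l) ≡ z ∷ restrict x y l
  restrict-∷-xy {z} l z∈xy with z ≡ᵇ x in z≡ᵇx | z ≡ᵇ y in z≡ᵇy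
  ... | true  | _    = refl
  ... | false | true = refl
  ... | false | false with z∈xy
  ...   | inj₁ refl = ⊥-elim (subst Bool.T z≡ᵇx (≡⇒≡ᵇ z z refl))
  ...   | inj₂ refl = ⊥-elim (subst Bool.T z≡ᵇy (≡⇒≡ᵇ z z refl))

  restrict-∷-other : ∀ {z} l → z ≢ x × z ≢ y → restrict x y (z ∷ l) ≡ restrict x y l
  restrict-∷-other {z} l (z≢x , z≢y) with z ≡ᵇ x in z≡ᵇx | z ≡ᵇ y in z≡ᵇy
  ... | true  | _     = ⊥-elim (z≢x (≡ᵇ⇒≡ z x (subst Bool.T (sym z≡ᵇx) tt)))
  ... | false | true  = ⊥-elim (z≢y (≡ᵇ⇒≡ z y (subst Bool.T (sym z≡ᵇy) tt)))
  ... | false | false = refl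

  restrict-++ : ∀ l m → restrict x y (l ++ m) ≡ restrict x y l ++ restrict x y m
  restrict-++ []      m = refl
  restrict-++ (z ∷ l) m with xy? z
  ... | inj₁ p rewrite restrict-∷-xy (l ++ m) p | restrict-∷-xy l p = cong (z ∷_) (restrict-++ l m)
  ... | inj₂ q rewrite restrict-∷-other (l ++ m) q | restrict-∷-other l q = restrict-++ l m

  restrict-concat : ∀ us → restrict x y (concat us) ≡ concat (map (restrict x y) us)
  restrict-concat []       = refl
  restrict-concat (u ∷ us) = trans (restrict-++ u (concat us)) (cong (restrict x y u ++_) (restrict-concat us))

  restrict-avoid : ∀ l → x ∉ l → y ∉ l → restrict x y l ≡ []
  restrict-avoid []      _   _   = refl
  restrict-avoid (z ∷ l) x∉l y∉l with xy? z
  ... | inj₁ (inj₁ refl) = ⊥-elim (x∉l (here refl))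
  ... | inj₁ (inj₂ refl) = ⊥-elim (y∉l (here refl))
  ... | inj₂ q rewrite restrict-∷-other l q = restrict-avoid l (x∉l ∘ there) (y∉l ∘ there)

  ∈-restrict⁻ : ∀ l {z} → z ∈ restrict x y l → z ∈ l × XY z
  ∈-restrict⁻ (u ∷ l) z∈ with xy? u
  ... | inj₂ q rewrite restrict-∷-other l q = Prod.map₁ there (∈-restrict⁻ l z∈)
  ... | inj₁ p rewrite restrict-∷-xy l p with z∈
  ...   | here refl = here refl , p
  ...   | there z∈′ = Prod.map₁ there (∈-restrict⁻ l z∈′)

  ∈-restrict⁺ : ∀ l {z} → XY z → z ∈ l → z ∈ restrict x y l
  ∈-restrict⁺ (u ∷ l) z∈xy z∈ with xy? u
  ... | inj₁ p rewrite restrict-∷-xy l p with z∈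
  ...   | here refl = here refl
  ...   | there z∈′ = there (∈-restrict⁺ l z∈xy z∈′)
  ∈-restrict⁺ (u ∷ l) z∈xy (here refl) | inj₂ (z≢x , z≢y) = ⊥-elim (Sum.[ z≢x , z≢y ]′ z∈xy)
  ∈-restrict⁺ (u ∷ l) z∈xy (there z∈) | inj₂ q rewrite restrict-∷-other l q = ∈-restrict⁺ l z∈xy z∈

  restrict-σ : ∀ l → restrict x y (σ l) ≡ σ (restrict x y l)
  restrict-σ []      = refl
  restrict-σ (w ∷ l) with xy? w | w ∈? l
  ... | inj₁ p | yes w∈l rewrite restrict-∷-xy l p | σ-∷-∈ (restrict x y l) (∈-restrict⁺ l p w∈l) =
    restrict-σ l
  ... | inj₁ p | no w∉l rewrite restrict-∷-xy (σ l) p | restrict-∷-xy l p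
                          | σ-∷-∉ (restrict x y l) (w∉l ∘ proj₁ ∘ ∈-restrict⁻ l) =
    cong (w ∷_) (restrict-σ l)
  ... | inj₂ q | yes _ rewrite restrict-∷-other l q = restrict-σ l
  ... | inj₂ q | no _  rewrite restrict-∷-other (σ l) q | restrict-∷-other l q = restrict-σ l

  restrict-unique : ∀ l → Unique l → Unique (restrict x y l)
  restrict-unique []      []           = []
  restrict-unique (z ∷ l) (z∉l ∷ !l) with xy? z
  ... | inj₁ p rewrite restrict-∷-xy l p =
    All.tabulate (λ u∈ → All.lookup z∉l (proj₁ (∈-restrict⁻ l u∈))) ∷ restrict-unique l !l
  ... | inj₂ q rewrite restrict-∷-other l q = restrict-unique l !l

  restrict-letters : ∀ l → All XY (restrict x y l)
  restrict-letters l = All.tabulate (proj₂ ∘ ∈-restrict⁻ l)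

  restrict-without-x : ∀ l → x ∉ l → All (_≡ y) (restrict x y l)
  restrict-without-x l x∉l = All.tabulate λ z∈ → case ∈-restrict⁻ l z∈ of λ where
    (z∈l , inj₁ refl) → ⊥-elim (x∉l z∈l)
    (_   , inj₂ z≡y)  → z≡y

  restrict-without-y : ∀ l → y ∉ l → All (_≡ x) (restrict x y l)
  restrict-without-y l y∉l = All.tabulate λ z∈ → case ∈-restrict⁻ l z∈ of λ where
    (_   , inj₁ z≡x)  → z≡x
    (z∈l , inj₂ refl) → ⊥-elim (y∉l z∈l)

  -- The trace has at most one letter.
  reverse-restrict : ∀ l → Unique l → ¬ (x ∈ l × y ∈ l) → reverse (restrict x y l) ≡ restrict x y l
  reverse-restrict l !l ¬both with x ∈? l
  ... | yes x∈l = reverse-constant-unique (restrict x y l)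
                    (restrict-without-y l (λ y∈l → ¬both (x∈l , y∈l))) (restrict-unique l !l)
  ... | no x∉l  = reverse-constant-unique (restrict x y l)
                    (restrict-without-x l x∉l) (restrict-unique l !l)

  restrict-concat-∈ : ∀ {w} us → AllPairs Disjoint us → w ∈ us → x ∈ w → y ∈ w →
    restrict x y (concat us) ≡ restrict x y w
  restrict-concat-∈ (u ∷ us) (u#us ∷ _) (here refl) x∈u y∈u
    rewrite restrict-++ u (concat us)
          | restrict-avoid (concat us) (λ x∈ → concat⁺ʳ u#us (x∈u , x∈)) (λ y∈ → concat⁺ʳ u#us (y∈u , y∈))
    = ++-identityʳ (restrict x y u)
  restrict-concat-∈ (u ∷ us) (u#us ∷ #us) (there w∈us) x∈w y∈w
    rewrite restrict-++ u (concat us)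
          | restrict-avoid u (λ x∈u → concat⁺ʳ u#us (x∈u , ∈-concat⁺′ x∈w w∈us))
                             (λ y∈u → concat⁺ʳ u#us (y∈u , ∈-concat⁺′ y∈w w∈us))
    = restrict-concat-∈ us #us w∈us x∈w y∈w

  restrict-concat-reverse : ∀ us → All (λ u → reverse (restrict x y u) ≡ restrict x y u) us →
    restrict x y (concat (reverse us)) ≡ reverse (restrict x y (concat us))
  restrict-concat-reverse []       []           = refl
  restrict-concat-reverse (u ∷ us) (pal ∷ pals) = begin
    restrict x y (concat (reverse (u ∷ us)))                         ≡⟨ cong (restrict x y) (concat-reverse-∷ u us) ⟩
    restrict x y (concat (reverse us) ++ u)                          ≡⟨ restrict-++ (concat (reverse us)) u ⟩
    restrict x y (concat (reverse us)) ++ restrict x y u             ≡⟨ cong₂ _++_ (restrict-concat-reverse us pals) (sym pal) ⟩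
    reverse (restrict x y (concat us)) ++ reverse (restrict x y u)  ≡⟨ reverse-++ (restrict x y u) _ ⟨
    reverse (restrict x y u ++ restrict x y (concat us))             ≡⟨ cong reverse (restrict-++ u (concat us)) ⟨
    reverse (restrict x y (concat (u ∷ us)))                         ∎

restrict-comm : ∀ x y l → restrict x y l ≡ restrict y x l
restrict-comm x y []      = refl
restrict-comm x y (z ∷ l) with xy? x y z
... | inj₁ p rewrite restrict-∷-xy x y l p | restrict-∷-xy y x l (Sum.swap p) = cong (z ∷_) (restrict-comm x y l)
... | inj₂ q rewrite restrict-∷-other x y l q | restrict-∷-other y x l (Prod.swap q) = restrict-comm x y l

-- Alternation

noAdjRepeat-∷⁻ : ∀ z l → NoAdjRepeat (z ∷ l) → NoAdjRepeat l
noAdjRepeat-∷⁻ z []      _       = tt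
noAdjRepeat-∷⁻ z (_ ∷ _) (_ , n) = n

noAdjRepeat-++⁻ˡ : ∀ A B → NoAdjRepeat (A ++ B) → NoAdjRepeat A
noAdjRepeat-++⁻ˡ []          B _       = tt
noAdjRepeat-++⁻ˡ (z ∷ [])    B _       = tt
noAdjRepeat-++⁻ˡ (z ∷ u ∷ A) B (p , n) = p , noAdjRepeat-++⁻ˡ (u ∷ A) B n

noAdjRepeat-++⁻ʳ : ∀ A B → NoAdjRepeat (A ++ B) → NoAdjRepeat B
noAdjRepeat-++⁻ʳ []      B n = n
noAdjRepeat-++⁻ʳ (z ∷ A) B n = noAdjRepeat-++⁻ʳ A B (noAdjRepeat-∷⁻ z (A ++ B) n)

¬noAdjRepeat-double : ∀ A (q : ℕ) B → ¬ NoAdjRepeat (A ++ q ∷ q ∷ B)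
¬noAdjRepeat-double []      q B (q≢q , _) = q≢q refl
¬noAdjRepeat-double (z ∷ A) q B n = ¬noAdjRepeat-double A q B (noAdjRepeat-∷⁻ z (A ++ q ∷ q ∷ B) n)

¬noAdjRepeat-mirror : ∀ A Q B → Q ≢ [] → ¬ NoAdjRepeat (A ++ reverse Q ++ Q ++ B)
¬noAdjRepeat-mirror A []      B Q≢[] _ = Q≢[] refl
¬noAdjRepeat-mirror A (q ∷ Q) B _    n =
  ¬noAdjRepeat-double (A ++ reverse Q) q (Q ++ B) (subst NoAdjRepeat (begin
  A ++ reverse (q ∷ Q) ++ (q ∷ Q) ++ B  ≡⟨ cong (λ t → A ++ t ++ q ∷ Q ++ B) (unfold-reverse q Q) ⟩
  A ++ (reverse Q ∷ʳ q) ++ q ∷ Q ++ B   ≡⟨ cong (A ++_) (++-assoc (reverse Q) [ q ] (q ∷ Q ++ B)) ⟩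
  A ++ reverse Q ++ q ∷ q ∷ Q ++ B      ≡⟨ ++-assoc A (reverse Q) _ ⟨
  (A ++ reverse Q) ++ q ∷ q ∷ Q ++ B    ∎) n)

¬noAdjRepeat-constant : ∀ {c : ℕ} B C D → All (_≡ c) B → B ≢ [] → All (_≡ c) C → C ≢ [] →
  ¬ NoAdjRepeat (B ++ C ++ D)
¬noAdjRepeat-constant []          C       D _               B≢[] _          _    _ = B≢[] refl
¬noAdjRepeat-constant B           []      D _               _    _          C≢[] _ = C≢[] refl
¬noAdjRepeat-constant (_ ∷ [])    (_ ∷ C) D (refl ∷ _)      _    (refl ∷ _) _    (b≢c , _) = b≢c refl
¬noAdjRepeat-constant (_ ∷ b ∷ B) C       D (_ ∷ b∷B≡c)    _    C≡c        C≢[] (_ , n) =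
  ¬noAdjRepeat-constant (b ∷ B) C D b∷B≡c (λ ()) C≡c C≢[] n

noAdjRepeat-repeat-pair : ∀ i (u v : ℕ) → u ≢ v → NoAdjRepeat (i ++ u ∷ v ∷ []) →
  NoAdjRepeat (i ++ u ∷ v ∷ u ∷ v ∷ [])
noAdjRepeat-repeat-pair []           u v u≢v _         = u≢v , u≢v ∘ sym , u≢v , tt
noAdjRepeat-repeat-pair (z ∷ [])     u v u≢v (z≢u , n) = z≢u , noAdjRepeat-repeat-pair [] u v u≢v n
noAdjRepeat-repeat-pair (z ∷ z′ ∷ i) u v u≢v (z≢z′ , n) = z≢z′ , noAdjRepeat-repeat-pair (z′ ∷ i) u v u≢v n

module _ {x y : ℕ} where

  xy-third≡first : ∀ {p q r} → XY x y p → XY x y q → XY x y r → p ≢ q → q ≢ r → p ≡ r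
  xy-third≡first (inj₁ refl) (inj₁ refl) _           p≢q _   = ⊥-elim (p≢q refl)
  xy-third≡first (inj₂ refl) (inj₂ refl) _           p≢q _   = ⊥-elim (p≢q refl)
  xy-third≡first _           (inj₁ refl) (inj₁ refl) _   q≢r = ⊥-elim (q≢r refl)
  xy-third≡first _           (inj₂ refl) (inj₂ refl) _   q≢r = ⊥-elim (q≢r refl)
  xy-third≡first (inj₁ refl) (inj₂ refl) (inj₁ refl) _   _   = refl
  xy-third≡first (inj₂ refl) (inj₁ refl) (inj₂ refl) _   _   = refl

  σ-alternating : ∀ p q l → All (XY x y) (p ∷ q ∷ l) → NoAdjRepeat (p ∷ q ∷ l) →
    ∃[ i ] ∃[ u ] ∃[ v ] p ∷ q ∷ l ≡ i ++ u ∷ v ∷ [] × σ (p ∷ q ∷ l) ≡ u ∷ v ∷ [] × u ≢ v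
  σ-alternating p q [] _ (p≢q , _) =
    [] , p , q , refl , σ-∷-∉ (q ∷ []) (λ { (here p≡q) → p≢q p≡q }) , p≢q
  σ-alternating p q (r ∷ l) (p∈xy ∷ qrl∈xy@(q∈xy ∷ r∈xy ∷ _)) (p≢q , n@(q≢r , _))
    with σ-alternating q r l qrl∈xy n
  ... | i , u , v , qrl≡ , σ≡ , u≢v =
    p ∷ i , u , v , cong (p ∷_) qrl≡ ,
    trans (σ-∷-∈ (q ∷ r ∷ l) (there (here (xy-third≡first p∈xy q∈xy r∈xy p≢q q≢r)))) σ≡ , u≢v

noAdjRepeat-++-σ : ∀ x y l → x ≢ y → All (XY x y) l → x ∈ l → y ∈ l → NoAdjRepeat l →
  NoAdjRepeat (l ++ σ l)
noAdjRepeat-++-σ x y (z ∷ [])    x≢y _  (here refl) (here refl) _ = ⊥-elim (x≢y refl)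
noAdjRepeat-++-σ x y (p ∷ q ∷ l) x≢y xy _           _           n with σ-alternating p q l xy n
... | i , u , v , l≡ , σ≡ , u≢v = subst NoAdjRepeat (sym (begin
      (p ∷ q ∷ l) ++ σ (p ∷ q ∷ l)        ≡⟨ cong₂ _++_ l≡ σ≡ ⟩
      (i ++ u ∷ v ∷ []) ++ u ∷ v ∷ []      ≡⟨ ++-assoc i _ _ ⟩
      i ++ u ∷ v ∷ u ∷ v ∷ []              ∎))
    (noAdjRepeat-repeat-pair i u v u≢v (subst NoAdjRepeat l≡ n))

alternate-++⁻ˡ : ∀ x y u v → Alternate x y (u ++ v) → Alternate x y u
alternate-++⁻ˡ x y u v alt =
  noAdjRepeat-++⁻ˡ (restrict x y u) (restrict x y v) (subst NoAdjRepeat (restrict-++ x y u v) alt)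

alternate-++-σ : ∀ x y w → x ≢ y → x ∈ w → y ∈ w → Alternate x y w → Alternate x y (w ++ σ w)
alternate-++-σ x y w x≢y x∈w y∈w alt =
  subst NoAdjRepeat (sym (trans (restrict-++ x y w (σ w)) (cong (restrict x y w ++_) (restrict-σ x y w))))
    (noAdjRepeat-++-σ x y (restrict x y w) x≢y (restrict-letters x y w)
      (∈-restrict⁺ x y w (inj₁ refl) x∈w) (∈-restrict⁺ x y w (inj₂ refl) y∈w) alt)

alternate-++-σ-σ : ∀ x y w → x ≢ y → x ∈ w → y ∈ w → Alternate x y w →
  Alternate x y (w ++ σ w ++ σ w)
alternate-++-σ-σ x y w x≢y x∈w y∈w alt =
  subst (Alternate x y) (trans (cong ((w ++ σ w) ++_) (σ-++-σ w)) (++-assoc w (σ w) (σ w)))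
    (alternate-++-σ x y (w ++ σ w) x≢y (∈-++⁺ˡ x∈w) (∈-++⁺ˡ y∈w)
      (alternate-++-σ x y w x≢y x∈w y∈w alt))

-- The construction

Represented : Graph × Word → Set
Represented p = Represents (proj₂ p) (proj₁ p) × SquareFree (proj₂ p)

⇔-absurd : ∀ {A B : Set} → ¬ A → ¬ B → A ⇔ B
⇔-absurd ¬A ¬B = mk⇔ (⊥-elim ∘ ¬A) (⊥-elim ∘ ¬B)

module Construction
  (G G₁ : Graph) (w⁻ : Word) (a : ℕ) (rest : List (Graph × Word))
  (rest≢[] : 1 ≤ length rest)
  (components : IsComponents G (G₁ ∷ map proj₁ rest))
  (rep₁ : Represents (w⁻ ∷ʳ a) G₁) (sf₁ : SquareFree (w⁻ ∷ʳ a))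
  (reps : All Represented rest)
  (edge₁ : HasEdge G₁)
  where

  w₁ P R s S W : Word
  w₁ = w⁻ ∷ʳ a
  ws : List Word
  ws = map proj₂ rest
  P  = concat ws
  R  = concat (reverse (map σ ws))
  s  = removeLast (σ w₁)
  S  = concat (map σ ws)
  W  = bigWord w₁ a w⁻ ws

  open Equivalence using (to; from)

  σw₁≡ : σ w₁ ≡ s ∷ʳ a
  σw₁≡ = σ-∷ʳ-removeLast w⁻ a

  InWord : ℕ → Graph × Word → Set
  InWord z p = z ∈ proj₂ p

  ∈P⁻ : ∀ {z} → z ∈ P → Any (InWord z) rest
  ∈P⁻ z∈P = AnyP.map⁻ (∈-concat⁻ ws z∈P)

  ∈P⁺ : ∀ {z} → Any (InWord z) rest → z ∈ P
  ∈P⁺ z∈ = ∈-concat⁺ (AnyP.map⁺ z∈)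

  word⇔vertices : ∀ {p} → p ∈ rest → ∀ z → z ∈ proj₂ p ⇔ z ∈ V (proj₁ p)
  word⇔vertices p∈ = proj₁ (proj₁ (All.lookup reps p∈))

  Components : List Graph
  Components = G₁ ∷ map proj₁ rest

  edges-agree : All (λ H → ∀ x y → x ∈ V H → y ∈ V H → E H x y ⇔ E G x y) Components
  edges-agree = proj₁ (proj₂ components)

  vertices : ∀ x → x ∈ V G ⇔ Any (λ H → x ∈ V H) Components
  vertices = proj₁ (proj₂ (proj₂ components))

  vertices-disjoint : AllPairs (λ H K → ∀ x → x ∈ V H → x ∉ V K) Components
  vertices-disjoint = proj₁ (proj₂ (proj₂ (proj₂ components)))

  no-edges-between : AllPairs (λ H K → ∀ x y → x ∈ V H → y ∈ V K → ¬ E G x y) Components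
  no-edges-between = proj₂ (proj₂ (proj₂ (proj₂ components)))

  word-of-vertex : ∀ {z} → Any (λ H → z ∈ V H) (map proj₁ rest) → Any (InWord z) rest
  word-of-vertex z∈ with find (AnyP.map⁻ z∈)
  ... | p , p∈ , z∈V = lose p∈ (from (word⇔vertices p∈ _) z∈V)

  vertex-of-word : ∀ {z} → Any (InWord z) rest → Any (λ H → z ∈ V H) (map proj₁ rest)
  vertex-of-word z∈ with find z∈
  ... | p , p∈ , z∈p = AnyP.map⁺ (lose p∈ (to (word⇔vertices p∈ _) z∈p))

  vertex⇔ : ∀ z → z ∈ V G ⇔ (z ∈ w₁ ⊎ z ∈ P)
  vertex⇔ z = mk⇔ classify unclassify
    where
    classify : z ∈ V G → z ∈ w₁ ⊎ z ∈ P
    classify z∈V with to (vertices z) z∈V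
    ... | here z∈V₁ = inj₁ (from (proj₁ rep₁ z) z∈V₁)
    ... | there z∈Vs = inj₂ (∈P⁺ (word-of-vertex z∈Vs))
    unclassify : z ∈ w₁ ⊎ z ∈ P → z ∈ V G
    unclassify (inj₁ z∈w₁) = from (vertices z) (here (to (proj₁ rep₁ z) z∈w₁))
    unclassify (inj₂ z∈P)  = from (vertices z) (there (vertex-of-word (∈P⁻ z∈P)))

  w₁#P : Disjoint w₁ P
  w₁#P (z∈w₁ , z∈P) with find (∈P⁻ z∈P)
  ... | p , p∈ , z∈p = All.lookup (AllPairs.head vertices-disjoint) (∈-map⁺ proj₁ p∈) _
                         (to (proj₁ rep₁ _) z∈w₁) (to (word⇔vertices p∈ _) z∈p)

  ws-disjoint : AllPairs Disjoint ws
  ws-disjoint = AllPairsP.map⁺ (allPairs-with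
    (λ rp rq V#V {_} (i , j) → V#V _ (to (proj₁ (proj₁ rp) _) i) (to (proj₁ (proj₁ rq) _) j))
    reps (AllPairsP.map⁻ (AllPairs.tail vertices-disjoint)))

  ws-squareFree : All SquareFree ws
  ws-squareFree = AllP.map⁺ (All.map proj₂ reps)

  letter-of-rest : ∃[ e ] e ∈ P
  letter-of-rest = some-letter rest rest≢[] reps (All.tail connected)
    where
    some-letter : ∀ qs → 1 ≤ length qs → All Represented qs → All Connected (map proj₁ qs) → ∃[ e ] e ∈ concat (map proj₂ qs)
    some-letter (q ∷ qs) _ ((rq , _) ∷ _) (((e , e∈V) , _) ∷ _) = e , ∈-++⁺ˡ (from (proj₁ rq e) e∈V)
    connected : All Connected Components
    connected = proj₁ components

  -- The two ends of an edge of G₁ are distinct, so they cannot both be the last letter a of σ w₁.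
  s≢[] : s ≢ []
  s≢[] s≡[] = E-irr G₁ (subst₂ (E G₁) (≡a (proj₁ (E-inV G₁ xy))) (≡a (proj₂ (E-inV G₁ xy))) xy)
    where
    x y : ℕ
    x = proj₁ edge₁
    y = proj₁ (proj₂ edge₁)
    xy : E G₁ x y
    xy = proj₂ (proj₂ edge₁)
    ≡a : ∀ {z} → z ∈ V G₁ → z ≡ a
    ≡a z∈V with subst (_ ∈_) (trans σw₁≡ (cong (_∷ʳ a) s≡[])) (∈-σ⁺ w₁ (from (proj₁ rep₁ _) z∈V))
    ... | here z≡a = z≡a

  a∈w₁ : a ∈ w₁
  a∈w₁ = ∈-++-∷ w⁻ []

  s⊆w₁ : ∀ {z} → z ∈ s → z ∈ w₁
  s⊆w₁ z∈s = ∈-σ⁻ w₁ (subst (_ ∈_) (sym σw₁≡) (∈-++⁺ˡ z∈s))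

  R⊆P : ∀ {z} → z ∈ R → z ∈ P
  R⊆P = ∈-concat-σ⁻ ws ∘ ∈-concat-reverse⁻ (map σ ws)

  P⊆R : ∀ {z} → z ∈ P → z ∈ R
  P⊆R = ∈-concat-reverse⁺ (map σ ws) ∘ ∈-concat-σ⁺ ws

  a∉s : a ∉ s
  a∉s = proj₂ (unique-∷ʳ⁻ s a (subst Unique σw₁≡ (σ-unique w₁)))

  S⊆P : ∀ {z} → z ∈ S → z ∈ P
  S⊆P = ∈-concat-σ⁻ ws

  P⊆S : ∀ {z} → z ∈ P → z ∈ S
  P⊆S = ∈-concat-σ⁺ ws

  σws-disjoint : AllPairs Disjoint (map σ ws)
  σws-disjoint = disjoint-σ ws ws-disjoint

  squareFree : SquareFree W
  squareFree = squareFree-construction w⁻ P R s S a sf₁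
    (squareFree-concat ws ws-squareFree ws-disjoint)
    (squareFree-concat (reverse (map σ ws)) (all-reverse (σ-squareFree ws))
      (allPairs-reverse #-sym σws-disjoint))
    (squareFree-concat (map σ ws) (σ-squareFree ws) σws-disjoint)
    (subst Unique σw₁≡ (σ-unique w₁))
    (λ (i , j) → w₁#P (in-w₁ i , in-P j))
    (∈⇒≢[] (proj₂ letter-of-rest)) (∈⇒≢[] (P⊆R (proj₂ letter-of-rest))) s≢[]
    where
    in-w₁ : ∀ {z} → z ∈ a ∷ w⁻ ++ s → z ∈ w₁
    in-w₁ (here refl) = a∈w₁
    in-w₁ (there z∈) = Sum.[ ∈-++⁺ˡ , s⊆w₁ ]′ (∈-++⁻ w⁻ z∈)
    in-P : ∀ {z} → z ∈ P ++ R ++ S → z ∈ P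
    in-P z∈ with ∈-++⁻ P z∈
    ... | inj₁ z∈P = z∈P
    ... | inj₂ z∈RS = Sum.[ R⊆P , S⊆P ]′ (∈-++⁻ R z∈RS)

  restrict-W : ∀ x y {b₁ b₂ b₃ b₄ b₅ b₆} →
    restrict x y w⁻ ≡ b₁ → restrict x y P ≡ b₂ → restrict x y [ a ] ≡ b₃ →
    restrict x y R ≡ b₄ → restrict x y s ≡ b₅ → restrict x y S ≡ b₆ →
    restrict x y W ≡ b₁ ++ b₂ ++ b₃ ++ b₄ ++ b₅ ++ b₆ ++ b₃
  restrict-W x y refl refl refl refl refl refl =
    trans (restrict-concat x y (w⁻ ∷ P ∷ [ a ] ∷ R ∷ s ∷ S ∷ [ a ] ∷ []))
      (cong (λ t → τ w⁻ ++ τ P ++ τ [ a ] ++ τ R ++ τ s ++ τ S ++ t) (++-identityʳ (τ [ a ])))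
    where
    τ : Word → Word
    τ = restrict x y

  alternate-w₁ : ∀ x y → x ≢ y → x ∈ w₁ → y ∈ w₁ → Alternate x y W ⇔ Alternate x y w₁
  alternate-w₁ x y x≢y x∈w₁ y∈w₁ =
    mk⇔ (alternate-++⁻ˡ x y w₁ (σ w₁) ∘ subst NoAdjRepeat trace)
        (subst NoAdjRepeat (sym trace) ∘ alternate-++-σ x y w₁ x≢y x∈w₁ y∈w₁)
    where
    τ : Word → Word
    τ = restrict x y
    avoid : ∀ l → (∀ {z} → z ∈ l → z ∈ P) → τ l ≡ []
    avoid l l⊆P = restrict-avoid x y l (λ x∈l → w₁#P (x∈w₁ , l⊆P x∈l)) (λ y∈l → w₁#P (y∈w₁ , l⊆P y∈l))
    trace : τ W ≡ τ (w₁ ++ σ w₁)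
    trace = trans (restrict-W x y refl (avoid P (λ z∈P → z∈P)) refl (avoid R R⊆P) refl (avoid S S⊆P)) (sym (begin
      τ (w₁ ++ σ w₁)                      ≡⟨ restrict-++ x y w₁ (σ w₁) ⟩
      τ w₁ ++ τ (σ w₁)                    ≡⟨ cong₂ _++_ (restrict-++ x y w⁻ [ a ])
                                              (trans (cong τ σw₁≡) (restrict-++ x y s [ a ])) ⟩
      (τ w⁻ ++ τ [ a ]) ++ τ s ++ τ [ a ] ≡⟨ ++-assoc (τ w⁻) (τ [ a ]) _ ⟩
      τ w⁻ ++ τ [ a ] ++ τ s ++ τ [ a ]   ∎))

  alternate-rest : ∀ x y {w} → x ≢ y → w ∈ ws → x ∈ w → y ∈ w → Alternate x y W ⇔ Alternate x y w
  alternate-rest x y {w} x≢y w∈ws x∈w y∈w =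
    mk⇔ (alternate-++⁻ˡ x y w (σ w ++ σ w) ∘ subst NoAdjRepeat trace)
        (subst NoAdjRepeat (sym trace) ∘ alternate-++-σ-σ x y w x≢y x∈w y∈w)
    where
    τ : Word → Word
    τ = restrict x y
    avoid : ∀ l → (∀ {z} → z ∈ l → z ∈ w₁) → τ l ≡ []
    avoid l l⊆w₁ = restrict-avoid x y l (λ x∈l → w₁#P (l⊆w₁ x∈l , ∈-concat⁺′ x∈w w∈ws))
                                      (λ y∈l → w₁#P (l⊆w₁ y∈l , ∈-concat⁺′ y∈w w∈ws))
    σw∈ : σ w ∈ map σ ws
    σw∈ = ∈-map⁺ σ w∈ws
    trace : τ W ≡ τ (w ++ σ w ++ σ w)
    trace = trans
      (restrict-W x y (avoid w⁻ ∈-++⁺ˡ) (restrict-concat-∈ x y ws ws-disjoint w∈ws x∈w y∈w)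
        (avoid [ a ] λ { (here refl) → a∈w₁ ; (there ()) })
        (restrict-concat-∈ x y (reverse (map σ ws)) (allPairs-reverse #-sym σws-disjoint)
          (AnyP.reverse⁺ σw∈) (∈-σ⁺ w x∈w) (∈-σ⁺ w y∈w))
        (avoid s s⊆w₁)
        (restrict-concat-∈ x y (map σ ws) σws-disjoint σw∈ (∈-σ⁺ w x∈w) (∈-σ⁺ w y∈w)))
      (sym (begin
        τ (w ++ σ w ++ σ w)            ≡⟨ restrict-++ x y w (σ w ++ σ w) ⟩
        τ w ++ τ (σ w ++ σ w)          ≡⟨ cong (τ w ++_) (restrict-++ x y (σ w) (σ w)) ⟩
        τ w ++ τ (σ w) ++ τ (σ w)      ≡⟨ cong (λ t → τ w ++ τ (σ w) ++ t) (++-identityʳ (τ (σ w))) ⟨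
        τ w ++ τ (σ w) ++ τ (σ w) ++ [] ∎))

  -- One of the junctions P | R or R | S of the trace has y's on both sides.
  ¬alternate-w₁-rest : ∀ x y → x ∈ w₁ → y ∈ P → ¬ Alternate x y W
  ¬alternate-w₁-rest x y x∈w₁ y∈P alt = by-cases (x ≟ a)
    where
    τ : Word → Word
    τ = restrict x y
    only-y : ∀ l → (∀ {z} → z ∈ l → z ∈ P) → All (_≡ y) (τ l)
    only-y l l⊆P = restrict-without-x x y l (λ x∈l → w₁#P (x∈w₁ , l⊆P x∈l))
    nonempty : ∀ l → (∀ {z} → z ∈ P → z ∈ l) → τ l ≢ []
    nonempty l P⊆l = ∈⇒≢[] (∈-restrict⁺ x y l (inj₂ refl) (P⊆l y∈P))
    by-cases : Dec (x ≡ a) → ⊥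
    by-cases (no x≢a) =
      ¬noAdjRepeat-constant (τ P) (τ R) _ (only-y P (λ z∈P → z∈P)) (nonempty P (λ z∈P → z∈P))
        (only-y R R⊆P) (nonempty R P⊆R)
        (noAdjRepeat-++⁻ʳ (τ w⁻) _ (subst NoAdjRepeat (restrict-W x y refl refl τa≡[] refl refl refl) alt))
      where
      τa≡[] : τ [ a ] ≡ []
      τa≡[] = restrict-avoid x y [ a ] (λ { (here x≡a) → x≢a x≡a }) (λ { (here refl) → w₁#P (a∈w₁ , y∈P) })
    by-cases (yes x≡a) =
      ¬noAdjRepeat-constant (τ R) (τ S) _ (only-y R R⊆P) (nonempty R P⊆R) (only-y S S⊆P) (nonempty S P⊆S)
        (noAdjRepeat-++⁻ʳ (τ [ a ]) _ (noAdjRepeat-++⁻ʳ (τ P) _ (noAdjRepeat-++⁻ʳ (τ w⁻) _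
          (subst NoAdjRepeat (restrict-W x y refl refl refl refl τs≡[] refl) alt))))
      where
      τs≡[] : τ s ≡ []
      τs≡[] = restrict-avoid x y s (a∉s ∘ subst (_∈ s) x≡a) (λ y∈s → w₁#P (s⊆w₁ y∈s , y∈P))

  Both : ℕ → ℕ → Graph × Word → Set
  Both x y p = x ∈ proj₂ p × y ∈ proj₂ p

  -- Each σ w has at most one of x and y, so the trace of R is the mirror image of that of S.
  ¬alternate-apart : ∀ x y → x ∈ P → y ∈ P → ¬ Any (Both x y) rest → ¬ Alternate x y W
  ¬alternate-apart x y x∈P y∈P apart alt =
    ¬noAdjRepeat-mirror (τ P) (τ S) [] (∈⇒≢[] (∈-restrict⁺ x y S (inj₁ refl) (P⊆S x∈P)))
      (subst NoAdjRepeat (restrict-W x y (avoid w⁻ ∈-++⁺ˡ) refl (avoid [ a ] λ { (here refl) → a∈w₁ ; (there ()) })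
        (restrict-concat-reverse x y (map σ ws) palindromes) (avoid s s⊆w₁) refl) alt)
    where
    τ : Word → Word
    τ = restrict x y
    avoid : ∀ l → (∀ {z} → z ∈ l → z ∈ w₁) → τ l ≡ []
    avoid l l⊆w₁ = restrict-avoid x y l (λ x∈l → w₁#P (l⊆w₁ x∈l , x∈P)) (λ y∈l → w₁#P (l⊆w₁ y∈l , y∈P))
    palindromes : All (λ u → reverse (τ u) ≡ τ u) (map σ ws)
    palindromes = AllP.map⁺ (AllP.map⁺ (All.map
      (λ {p} ¬both → reverse-restrict x y (σ (proj₂ p)) (σ-unique (proj₂ p))
                       (λ (x∈ , y∈) → ¬both (∈-σ⁻ _ x∈ , ∈-σ⁻ _ y∈)))
      (AllP.¬Any⇒All¬ rest apart)))

  edge-w₁ : ∀ x y → x ≢ y → x ∈ w₁ → y ∈ w₁ → Alternate x y w₁ ⇔ E G x y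
  edge-w₁ x y x≢y x∈w₁ y∈w₁ = ⇔-trans (proj₂ rep₁ x y x∈V y∈V x≢y) (All.head edges-agree x y x∈V y∈V)
    where
    x∈V = to (proj₁ rep₁ x) x∈w₁
    y∈V = to (proj₁ rep₁ y) y∈w₁

  edge-rest : ∀ x y → x ≢ y → Any (Both x y) rest →
    ∃[ w ] w ∈ ws × x ∈ w × y ∈ w × (Alternate x y w ⇔ E G x y)
  edge-rest x y x≢y both with find both
  ... | p , p∈ , x∈p , y∈p =
    proj₂ p , ∈-map⁺ proj₂ p∈ , x∈p , y∈p ,
    ⇔-trans (proj₂ (proj₁ (All.lookup reps p∈)) x y x∈V y∈V x≢y)
            (All.lookup (All.tail edges-agree) (∈-map⁺ proj₁ p∈) x y x∈V y∈V)
    where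
    x∈V = to (word⇔vertices p∈ x) x∈p
    y∈V = to (word⇔vertices p∈ y) y∈p

  no-edge-w₁-rest : ∀ x y → x ∈ w₁ → y ∈ P → ¬ E G x y
  no-edge-w₁-rest x y x∈w₁ y∈P with find (∈P⁻ y∈P)
  ... | p , p∈ , y∈p = All.lookup (AllPairs.head no-edges-between) (∈-map⁺ proj₁ p∈) x y
                         (to (proj₁ rep₁ x) x∈w₁) (to (word⇔vertices p∈ y) y∈p)

  rest-no-edges : AllPairs (λ p q → ∀ x y → x ∈ proj₂ p → y ∈ proj₂ q → ¬ E G x y) rest
  rest-no-edges = allPairs-with
    (λ rp rq no-edge x y x∈ y∈ → no-edge x y (to (proj₁ (proj₁ rp) x) x∈) (to (proj₁ (proj₁ rq) y) y∈))
    reps (AllPairsP.map⁻ (AllPairs.tail no-edges-between))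

  no-edge-apart : ∀ x y → x ∈ P → y ∈ P → ¬ Any (Both x y) rest → ¬ E G x y
  no-edge-apart x y x∈P y∈P apart xy with any-pair rest-no-edges (∈P⁻ x∈P) (∈P⁻ y∈P)
  ... | inj₁ both = apart both
  ... | inj₂ (inj₁ (_ , _ , no-edge , x∈ , y∈)) = no-edge x y x∈ y∈ xy
  ... | inj₂ (inj₂ (_ , _ , no-edge , y∈ , x∈)) = no-edge y x y∈ x∈ (E-sym G xy)

  letters : ∀ z → z ∈ W ⇔ z ∈ V G
  letters z = ⇔-trans (mk⇔ home unhome) (⇔-sym (vertex⇔ z))
    where
    home : z ∈ W → z ∈ w₁ ⊎ z ∈ P
    home z∈ with ∈-++⁻ w⁻ z∈
    ... | inj₁ z∈w⁻ = inj₁ (∈-++⁺ˡ z∈w⁻)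
    ... | inj₂ z∈ with ∈-++⁻ P z∈
    ...   | inj₁ z∈P         = inj₂ z∈P
    ...   | inj₂ (here refl) = inj₁ a∈w₁
    ...   | inj₂ (there z∈) with ∈-++⁻ R z∈
    ...     | inj₁ z∈R = inj₂ (R⊆P z∈R)
    ...     | inj₂ z∈ with ∈-++⁻ s z∈
    ...       | inj₁ z∈s = inj₁ (s⊆w₁ z∈s)
    ...       | inj₂ z∈ with ∈-++⁻ S z∈
    ...         | inj₁ z∈S         = inj₂ (S⊆P z∈S)
    ...         | inj₂ (here refl) = inj₁ a∈w₁
    unhome : z ∈ w₁ ⊎ z ∈ P → z ∈ W
    unhome (inj₂ z∈P) = ∈-++⁺ʳ w⁻ (∈-++⁺ˡ z∈P)
    unhome (inj₁ z∈w₁) with ∈-++⁻ w⁻ z∈w₁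
    ... | inj₁ z∈w⁻        = ∈-++⁺ˡ z∈w⁻
    ... | inj₂ (here refl) = ∈-++⁺ʳ w⁻ (∈-++⁺ʳ P (here refl))

  alternation : ∀ x y → x ∈ V G → y ∈ V G → x ≢ y → Alternate x y W ⇔ E G x y
  alternation x y x∈V y∈V x≢y with to (vertex⇔ x) x∈V | to (vertex⇔ y) y∈V
  ... | inj₁ x∈w₁ | inj₁ y∈w₁ = ⇔-trans (alternate-w₁ x y x≢y x∈w₁ y∈w₁) (edge-w₁ x y x≢y x∈w₁ y∈w₁)
  ... | inj₁ x∈w₁ | inj₂ y∈P  = ⇔-absurd (¬alternate-w₁-rest x y x∈w₁ y∈P) (no-edge-w₁-rest x y x∈w₁ y∈P)
  ... | inj₂ x∈P  | inj₁ y∈w₁ =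
    ⇔-absurd (¬alternate-w₁-rest y x y∈w₁ x∈P ∘ subst NoAdjRepeat (restrict-comm x y W))
             (no-edge-w₁-rest y x y∈w₁ x∈P ∘ E-sym G)
  ... | inj₂ x∈P  | inj₂ y∈P with Any.any? (λ p → (x ∈? proj₂ p) ×-dec (y ∈? proj₂ p)) rest
  ...   | no apart = ⇔-absurd (¬alternate-apart x y x∈P y∈P apart) (no-edge-apart x y x∈P y∈P apart)
  ...   | yes both with edge-rest x y x≢y both
  ...     | w , w∈ws , x∈w , y∈w , alternate⇔edge =
    ⇔-trans (alternate-rest x y x≢y w∈ws x∈w y∈w) alternate⇔edge

  represents : Represents W G
  represents = letters , alternation

mainTheorem5 : (G G₁ : Graph) (w₁ : Word) (rest : List (Graph × Word)) →
    1 ≤ length rest →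
    IsComponents G (G₁ ∷ map proj₁ rest) →
    Represents w₁ G₁ → SquareFree w₁ →
    All (λ p → Represents (proj₂ p) (proj₁ p) × SquareFree (proj₂ p)) rest →
    HasEdge G₁ →
    (w₁⁻ : Word) (a : ℕ) → w₁ ≡ w₁⁻ ++ [ a ] →
    Represents (bigWord w₁ a w₁⁻ (map proj₂ rest)) G ×
    SquareFree (bigWord w₁ a w₁⁻ (map proj₂ rest))
mainTheorem5 G G₁ _ rest rest≢[] components rep₁ sf₁ reps edge₁ w⁻ a refl =
  represents , squareFree
  where open Construction G G₁ w⁻ a rest rest≢[] components rep₁ sf₁ reps edge₁
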